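{- Let $k>1$, $A=\mathbb{Z}_3^k$, and let $T$ be a caterpillar with spine path $s_1s_2s_3$ and $|V(T)|=3^k$, where $X,Y,Z$ are the sets of leaves attached to $s_1,s_2,s_3$ respectively. Then $T$ is $A$-rainbow if and only if none of the following holds: 1. $|X|\equiv0\pmod 3$ and $|Z|\equiv2\pmod 3$, or $|X|\equiv2\pmod3$ and $|Z|\equiv0\pmod3$; 2. $|Y|=0$ and either ($|X|\equiv1\pmod3$ and $|Z|\equiv2\pmod3$) or ($|X|\equiv2\pmod3$ and $|Z|\equiv1\pmod3$).
   Context: For an Abelian group $A$ and a tree $T$ with $|V(T)|=|A|$, a labeling $f\colon V(T)\to A$ induces the edge labeling $uv\mapsto f(u)+f(v)$. $f$ is an $A$-rainbow labeling if $f$ is a bijection and all edges receive distinct labels; $T$ is $A$-rainbow if it admits such a labeling. -}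

module Defs where

open import Data.Nat using (ℕ; _+_)
open import Data.Nat.DivMod using (_mod_)
open import Data.Fin using (Fin; toℕ)
open import Data.Vec using (Vec; zipWith)
open import Data.Product using (Σ; ∃; _×_; _,_; proj₁; proj₂)
open import Relation.Binary.PropositionalEquality using (_≡_)
open import Function.Definitions using (Bijective; Injective)

_+₃_ : Fin 3 → Fin 3 → Fin 3
a +₃ b = (toℕ a + toℕ b) mod 3

Z3^ : ℕ → Set
Z3^ k = Vec (Fin 3) k

_⊕_ : {k : ℕ} → Z3^ k → Z3^ k → Z3^ k
_⊕_ = zipWith _+₃_

IsRainbowLabeling : {V E : Set} (k : ℕ) (ends : E → V × V) (f : V → Z3^ k) → Set
IsRainbowLabeling k ends f =
  Bijective _≡_ _≡_ f ×
  Injective _≡_ _≡_ (λ e → f (proj₁ (ends e)) ⊕ f (proj₂ (ends e)))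

IsRainbow : {V E : Set} (k : ℕ) (ends : E → V × V) → Set
IsRainbow {V} k ends = Σ (V → Z3^ k) (IsRainbowLabeling k ends)

-- The caterpillar with spine s₁ s₂ s₃ and leaf sets X, Y, Z of sizes x, y, z
-- attached to s₁, s₂, s₃ respectively.  (Up to isomorphism this is every such tree.)
data CatVertex (x y z : ℕ) : Set where
  s₁ s₂ s₃ : CatVertex x y z
  leafX : Fin x → CatVertex x y z
  leafY : Fin y → CatVertex x y z
  leafZ : Fin z → CatVertex x y z

data CatEdge (x y z : ℕ) : Set where
  e₁₂ e₂₃ : CatEdge x y z
  eX : Fin x → CatEdge x y z
  eY : Fin y → CatEdge x y z
  eZ : Fin z → CatEdge x y z

catEnds : {x y z : ℕ} → CatEdge x y z → CatVertex x y z × CatVertex x y z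
catEnds e₁₂ = s₁ , s₂
catEnds e₂₃ = s₂ , s₃
catEnds (eX i) = s₁ , leafX i
catEnds (eY i) = s₂ , leafY i
catEnds (eZ i) = s₃ , leafZ i

-- Necessity. Root the caterpillar at s₂ and let a, b, c be the labels of s₁, s₂, s₃. The
-- 3^k − 1 edge labels are all elements but one, m; adding up every element once in the two
-- ways (vertex labels, or m and the edge labels) gives m + b + x·a + y·b + z·c = 0. For
-- residues (0,1,2) this forces m = b + c, the label of s₂s₃, and for (2,1,0) it forces
-- m = a + b, the label of s₁s₂. If Y is empty, translating a neighbour of s₁ by t = a − c
-- cannot give a neighbour of s₃, since an edge at s₁ and one at s₃ would share a label;
-- following b shows b + t = c, after which translation by t permutes the labels of X, so
-- x·t = 0 with t ≠ 0 and 3 divides x.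
--
-- Sufficiency. A labelling is described from the group side by the role of the vertex
-- carrying each element. Such colourings of ℤ₃^n stack, three at a time, to colourings of
-- ℤ₃^(n+1) whose spine labels get a new coordinate 0: the edge labels in layer i have
-- first coordinate i, so they stay distinct. Stacking one colouring containing the spine on
-- two all-leaf colourings, recursively down to colourings of ℤ₃ (collinear spine labels)
-- and ℤ₃² (skew spine labels) checked by evaluation, realises every admissible (x, y, z).

module Submission where

open import Defs
open import Data.Nat using (ℕ; zero; suc; _+_; _*_; _∸_; _^_; _<_; _%_; s≤s; z≤n) renaming (_≟_ to _≟ⁿ_)
open import Data.Nat.Tactic.RingSolver using (solve-∀)
open import Data.Nat.DivMod using (m≡m%n+[m/n]*n; _/_; m%n<n; %-distribˡ-+; m%n%n≡m%n; [m+n]%n≡m%n; m*n%n≡0)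
open import Data.Nat.Properties using (+-comm; *-comm; *-distribˡ-+; *-cancelˡ-≡; 1+n≰n; +-identityʳ; m+n≡0⇒m≡0; m+n≡0⇒n≡0; suc-injective)
open import Data.Bool using (Bool; true; false; T; if_then_else_)
open import Data.Bool.Properties using (T-irrelevant)
open import Data.Unit using (⊤; tt)
open import Data.Empty using (⊥; ⊥-elim)
open import Data.Fin using (Fin; zero; suc; toℕ; fromℕ<; splitAt; punchOut)
open import Data.Fin.Properties using (toℕ-fromℕ<; all?; any?; ¬∀⟶∃¬; +↔⊎; injective⇒≤; punchOut-injective) renaming (_≟_ to _≟ᶠ_)
open import Data.Fin.Permutation using (permutation)
open import Data.Vec using (Vec; []; _∷_; replicate; map; lookup; zipWith; sum)
open import Data.Vec.Properties using (≡-dec; ∷-injective; zipWith-assoc; zipWith-comm; zipWith-identityˡ; zipWith-identityʳ; zipWith-inverseˡ; zipWith-inverseʳ)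
open import Data.Product using (Σ; ∃; ∃₂; _×_; _,_; proj₁; proj₂; map₂)
open import Data.Sum using (_⊎_; inj₁; inj₂; map₁)
open import Data.Maybe using (Maybe; nothing; just)
open import Data.Sum.Function.Propositional using (_⊎-↔_)
open import Function using (_∘_)
open import Function.Bundles using (_↔_; Inverse; Bijection; Injection; mk↔ₛ′; _⇔_; mk⇔)
open import Function.Definitions using (Injective)
open import Function.Properties.Inverse using (↔-refl; ↔-sym; ↔-trans; Inverse⇒Bijection; Inverse⇒Injection)
open import Relation.Nullary using (¬_; Dec; yes; no)
open import Relation.Nullary.Decidable using (True; toWitness; fromWitness; ⌊_⌋; map′; ¬?; _×-dec_; _→-dec_)
open import Relation.Binary.Definitions using (DecidableEquality)
open import Relation.Binary.PropositionalEquality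
open import Algebra.Bundles using (AbelianGroup)

-₃_ : Fin 3 → Fin 3
-₃ a = a +₃ a

+₃-assoc : ∀ a b c → (a +₃ b) +₃ c ≡ a +₃ (b +₃ c)
+₃-assoc = toWitness {a? = all? λ a → all? λ b → all? λ c → (a +₃ b) +₃ c ≟ᶠ a +₃ (b +₃ c)} _

+₃-comm : ∀ a b → a +₃ b ≡ b +₃ a
+₃-comm = toWitness {a? = all? λ a → all? λ b → a +₃ b ≟ᶠ b +₃ a} _

+₃-identityˡ : ∀ a → zero +₃ a ≡ a
+₃-identityˡ = toWitness {a? = all? λ a → zero +₃ a ≟ᶠ a} _

+₃-inverseˡ : ∀ a → (-₃ a) +₃ a ≡ zero
+₃-inverseˡ = toWitness {a? = all? λ a → (-₃ a) +₃ a ≟ᶠ zero} _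

0ᵛ : ∀ {k} → Z3^ k
0ᵛ = replicate _ zero

ℤ₃^ : ℕ → AbelianGroup _ _
ℤ₃^ k = record
  { Carrier = Z3^ k ; _≈_ = _≡_ ; _∙_ = _⊕_ ; ε = 0ᵛ ; _⁻¹ = map -₃_
  ; isAbelianGroup = record
    { isGroup = record
      { isMonoid = record
        { isSemigroup = record
          { isMagma = record { isEquivalence = isEquivalence ; ∙-cong = cong₂ _⊕_ }
          ; assoc = zipWith-assoc +₃-assoc }
        ; identity = zipWith-identityˡ +₃-identityˡ
                   , zipWith-identityʳ (λ a → trans (+₃-comm a zero) (+₃-identityˡ a)) }
      ; inverse = zipWith-inverseˡ +₃-inverseˡ
                , zipWith-inverseʳ (λ a → trans (+₃-comm a _) (+₃-inverseˡ a))
      ; ⁻¹-cong = cong (map -₃_) }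
    ; comm = zipWith-comm +₃-comm } }

third-residue : ∀ {a b c} → a < 3 → b < 3 → c < 3 → (a + b + c) % 3 ≡ 0 → b ≡ (6 ∸ (a + c)) % 3
third-residue a<3 b<3 c<3
  with fromℕ< a<3 | toℕ-fromℕ< a<3 | fromℕ< b<3 | toℕ-fromℕ< b<3 | fromℕ< c<3 | toℕ-fromℕ< c<3
... | i | refl | j | refl | l | refl = check i j l
  where
  check : ∀ (i j l : Fin 3) → (toℕ i + toℕ j + toℕ l) % 3 ≡ 0 → toℕ j ≡ (6 ∸ (toℕ i + toℕ l)) % 3
  check = toWitness {a? = all? λ i → all? λ j → all? λ l →
    ((toℕ i + toℕ j + toℕ l) % 3 ≟ⁿ 0) →-dec (toℕ j ≟ⁿ (6 ∸ (toℕ i + toℕ l)) % 3)} _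

residues-sum : ∀ x y z → (x + y + z) % 3 ≡ (x % 3 + y % 3 + z % 3) % 3
residues-sum x y z = begin
  (x + y + z) % 3                        ≡⟨ %-distribˡ-+ (x + y) z 3 ⟩
  ((x + y) % 3 + z % 3) % 3              ≡⟨ cong (λ w → (w + z % 3) % 3) (%-distribˡ-+ x y 3) ⟩
  ((x % 3 + y % 3) % 3 + z % 3) % 3      ≡⟨ cong (λ w → ((x % 3 + y % 3) % 3 + w) % 3) (sym (m%n%n≡m%n z 3)) ⟩
  ((x % 3 + y % 3) % 3 + z % 3 % 3) % 3  ≡⟨ sym (%-distribˡ-+ (x % 3 + y % 3) (z % 3) 3) ⟩
  (x % 3 + y % 3 + z % 3) % 3            ∎
  where open ≡-Reasoning

residue-y : ∀ n x y z {r s} → 3 + x + y + z ≡ 3 ^ suc n → x % 3 ≡ r → z % 3 ≡ s → y % 3 ≡ (6 ∸ (r + s)) % 3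
residue-y n x y z h refl refl =
  third-residue (m%n<n x 3) (m%n<n y 3) (m%n<n z 3) (trans (sym (residues-sum x y z)) total)
  where
  open ≡-Reasoning
  total : (x + y + z) % 3 ≡ 0
  total = begin
    (x + y + z) % 3        ≡⟨ sym ([m+n]%n≡m%n (x + y + z) 3) ⟩
    (x + y + z + 3) % 3    ≡⟨ cong (_% 3) (trans (+-comm (x + y + z) 3) (sym (+-assoc3 x y z))) ⟩
    (3 + x + y + z) % 3    ≡⟨ cong (_% 3) h ⟩
    (3 * 3 ^ n) % 3        ≡⟨ cong (_% 3) (*-comm 3 (3 ^ n)) ⟩
    (3 ^ n * 3) % 3        ≡⟨ m*n%n≡0 (3 ^ n) 3 ⟩
    0                      ∎
    where
    +-assoc3 : ∀ x y z → 3 + x + y + z ≡ 3 + (x + y + z)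
    +-assoc3 = solve-∀

decompose : ∀ {x r} → x % 3 ≡ r → x ≡ r + 3 * (x / 3)
decompose {x} refl = trans (m≡m%n+[m/n]*n x 3) (cong (x % 3 +_) (*-comm (x / 3) 3))

residue-cases : ∀ n → n % 3 ≡ 0 ⊎ n % 3 ≡ 1 ⊎ n % 3 ≡ 2
residue-cases n with n % 3 | m%n<n n 3
... | 0 | _ = inj₁ refl
... | 1 | _ = inj₂ (inj₁ refl)
... | 2 | _ = inj₂ (inj₂ refl)
... | suc (suc (suc _)) | s≤s (s≤s (s≤s ()))

count : ∀ {n} → (Z3^ n → Bool) → ℕ
count {zero}  P = if P [] then 1 else 0
count {suc n} P = count (λ u → P (zero ∷ u))
                + (count (λ u → P (suc zero ∷ u)) + count (λ u → P (suc (suc zero) ∷ u)))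

Satisfying : ∀ {n} → (Z3^ n → Bool) → Set
Satisfying P = Σ _ (T ∘ P)

enumeration : ∀ {n} (P : Z3^ n → Bool) → Fin (count P) ↔ Satisfying P
enumeration {zero} P = ↔-trans (fin-if (P [])) (mk↔ₛ′ ([] ,_) (λ { ([] , p) → p }) (λ { ([] , _) → refl }) (λ _ → refl))
  where
  fin-if : ∀ b → Fin (if b then 1 else 0) ↔ T b
  fin-if true  = mk↔ₛ′ _ (λ _ → zero) (λ _ → refl) (λ { zero → refl })
  fin-if false = mk↔ₛ′ (λ ()) (λ ()) (λ ()) (λ ())
enumeration {suc n} P =
  ↔-trans +↔⊎ (↔-trans (↔-refl ⊎-↔ +↔⊎)
    (↔-trans (enumeration _ ⊎-↔ (enumeration _ ⊎-↔ enumeration _)) layers))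
  where
  layers : (Satisfying (λ u → P (zero ∷ u))
           ⊎ (Satisfying (λ u → P (suc zero ∷ u)) ⊎ Satisfying (λ u → P (suc (suc zero) ∷ u))))
         ↔ Satisfying P
  layers = mk↔ₛ′ to from to-from from-to
    where
    to : _ → Satisfying P
    to (inj₁ (u , p))        = zero ∷ u , p
    to (inj₂ (inj₁ (u , p))) = suc zero ∷ u , p
    to (inj₂ (inj₂ (u , p))) = suc (suc zero) ∷ u , p
    from : Satisfying P → _
    from (zero ∷ u , p)           = inj₁ (u , p)
    from (suc zero ∷ u , p)       = inj₂ (inj₁ (u , p))
    from (suc (suc zero) ∷ u , p) = inj₂ (inj₂ (u , p))
    to-from : ∀ w → to (from w) ≡ w
    to-from (zero ∷ u , p)           = refl
    to-from (suc zero ∷ u , p)       = refl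
    to-from (suc (suc zero) ∷ u , p) = refl
    from-to : ∀ w → from (to w) ≡ w
    from-to (inj₁ _)        = refl
    from-to (inj₂ (inj₁ _)) = refl
    from-to (inj₂ (inj₂ _)) = refl

-- Colourings of ℤ₃^n by vertex roles

data Pos : Set where
  p₁ p₂ p₃ : Pos

data Role : Set where
  spine leaf : Pos → Role

_≟ᴾ_ : DecidableEquality Pos
p₁ ≟ᴾ p₁ = yes refl
p₁ ≟ᴾ p₂ = no λ ()
p₁ ≟ᴾ p₃ = no λ ()
p₂ ≟ᴾ p₁ = no λ ()
p₂ ≟ᴾ p₂ = yes refl
p₂ ≟ᴾ p₃ = no λ ()
p₃ ≟ᴾ p₁ = no λ ()
p₃ ≟ᴾ p₂ = no λ ()
p₃ ≟ᴾ p₃ = yes refl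

_≟ᴿ_ : DecidableEquality Role
spine p ≟ᴿ spine q = map′ (cong spine) (λ { refl → refl }) (p ≟ᴾ q)
leaf p  ≟ᴿ leaf q  = map′ (cong leaf) (λ { refl → refl }) (p ≟ᴾ q)
spine _ ≟ᴿ leaf _  = no λ ()
leaf _  ≟ᴿ spine _ = no λ ()

Profile : Set
Profile = Pos → ℕ

size : ∀ {n} → (Z3^ n → Role) → Role → ℕ
size role r = count (λ u → ⌊ role u ≟ᴿ r ⌋)

-- Rooted at s₂, every other vertex hangs from its parent on the spine; the root's parent is junk.
parent : Role → Pos
parent (spine _) = p₂
parent (leaf p)  = p

edgeAbove : ∀ {n} → (Pos → Z3^ n) → (Z3^ n → Role) → Z3^ n → Z3^ n
edgeAbove σ role u = σ (parent (role u)) ⊕ u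

EdgesDistinct : ∀ {n} → (Pos → Z3^ n) → (Z3^ n → Role) → Set
EdgesDistinct σ role = ∀ {u v} → role u ≢ spine p₂ → role v ≢ spine p₂ →
  edgeAbove σ role u ≡ edgeAbove σ role v → u ≡ v

-- A labelling seen from its values: role u is the role of the vertex labelled u,
-- and σ p is the label of the spine vertex at p.
record Colouring (n : ℕ) (σ : Pos → Z3^ n) (s : Profile) : Set where
  field
    role           : Z3^ n → Role
    edges-distinct : EdgesDistinct σ role
    sizes          : ∀ p → size role (leaf p) ≡ s p

record LeafColouring (n : ℕ) (σ : Pos → Z3^ n) (s : Profile) : Set where
  field
    colouring : Colouring n σ s
  open Colouring colouring public
  field
    leaves-only : ∀ u p → role u ≢ spine p

record RainbowColouring (n : ℕ) (σ : Pos → Z3^ n) (s : Profile) : Set where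
  field
    colouring : Colouring n σ s
  open Colouring colouring public
  field
    spine-at   : ∀ p → role (σ p) ≡ spine p
    spine-only : ∀ {u p} → role u ≡ spine p → u ≡ σ p

lift : ∀ {n} → (Pos → Z3^ n) → Pos → Z3^ (suc n)
lift σ p = zero ∷ σ p

glue : ∀ {n} → (Fin 3 → Z3^ n → Role) → Z3^ (suc n) → Role
glue L (i ∷ u) = L i u

glue-edgesDistinct : ∀ {n σ} (L : Fin 3 → Z3^ n → Role) →
  (∀ i → EdgesDistinct σ (L i)) → EdgesDistinct (lift σ) (glue L)
glue-edgesDistinct L distinct {i ∷ u} {j ∷ v} ru rv eq
  with ∷-injective eq
... | i≡j , tail-eq
  with trans (sym (+₃-identityˡ i)) (trans i≡j (+₃-identityˡ j))
... | refl = cong (i ∷_) (distinct i ru rv tail-eq)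

_⊞_ : Profile → Profile → Profile
(s ⊞ t) p = s p + t p

infixr 6 _⊞_

stack : ∀ {n σ s₀ s₁ s₂} → Colouring n σ s₀ → Colouring n σ s₁ → Colouring n σ s₂ →
  Colouring (suc n) (lift σ) (s₀ ⊞ s₁ ⊞ s₂)
stack {σ = σ} C₀ C₁ C₂ = record
  { role           = glue L
  ; edges-distinct = glue-edgesDistinct {σ = σ} L λ
      { zero → C.edges-distinct C₀ ; (suc zero) → C.edges-distinct C₁ ; (suc (suc zero)) → C.edges-distinct C₂ }
  ; sizes          = λ p → cong₂ _+_ (C.sizes C₀ p) (cong₂ _+_ (C.sizes C₁ p) (C.sizes C₂ p))
  }
  where
  module C = Colouring
  L : Fin 3 → Z3^ _ → Role
  L zero             = C.role C₀
  L (suc zero)       = C.role C₁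
  L (suc (suc zero)) = C.role C₂

stack-leaves : ∀ {n σ s₀ s₁ s₂} → LeafColouring n σ s₀ → LeafColouring n σ s₁ → LeafColouring n σ s₂ →
  LeafColouring (suc n) (lift σ) (s₀ ⊞ s₁ ⊞ s₂)
stack-leaves C₀ C₁ C₂ = record
  { colouring   = stack (L.colouring C₀) (L.colouring C₁) (L.colouring C₂)
  ; leaves-only = λ { (zero ∷ u) → L.leaves-only C₀ u ; (suc zero ∷ u) → L.leaves-only C₁ u
                    ; (suc (suc zero) ∷ u) → L.leaves-only C₂ u }
  }
  where module L = LeafColouring

stack-rainbow : ∀ {n σ s₀ s₁ s₂} → RainbowColouring n σ s₀ → LeafColouring n σ s₁ → LeafColouring n σ s₂ →
  RainbowColouring (suc n) (lift σ) (s₀ ⊞ s₁ ⊞ s₂)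
stack-rainbow C₀ C₁ C₂ = record
  { colouring  = stack (R.colouring C₀) (L.colouring C₁) (L.colouring C₂)
  ; spine-at   = R.spine-at C₀
  ; spine-only = λ { {zero ∷ u} e → cong (zero ∷_) (R.spine-only C₀ e)
                   ; {suc zero ∷ u} e → ⊥-elim (L.leaves-only C₁ u _ e)
                   ; {suc (suc zero) ∷ u} e → ⊥-elim (L.leaves-only C₂ u _ e) }
  }
  where
  module R = RainbowColouring
  module L = LeafColouring

resize : ∀ {n σ s t} → (∀ p → s p ≡ t p) → Colouring n σ s → Colouring n σ t
resize s≗t C = record { Colouring C ; sizes = λ p → trans (Colouring.sizes C p) (s≗t p) }

resize-leaves : ∀ {n σ s t} → (∀ p → s p ≡ t p) → LeafColouring n σ s → LeafColouring n σ t
resize-leaves s≗t C = record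
  { colouring = resize s≗t (LeafColouring.colouring C) ; leaves-only = LeafColouring.leaves-only C }

resize-rainbow : ∀ {n σ s t} → (∀ p → s p ≡ t p) → RainbowColouring n σ s → RainbowColouring n σ t
resize-rainbow s≗t C = record
  { colouring = resize s≗t (RainbowColouring.colouring C)
  ; spine-at = RainbowColouring.spine-at C ; spine-only = RainbowColouring.spine-only C }

Σ-cong : ∀ {R : Set} {A B : R → Set} → (∀ r → A r ↔ B r) → Σ R A ↔ Σ R B
Σ-cong e = mk↔ₛ′ (map₂ (Inverse.to (e _))) (map₂ (Inverse.from (e _)))
  (λ (r , b) → cong (r ,_) (Inverse.strictlyInverseˡ (e r) b))
  (λ (r , a) → cong (r ,_) (Inverse.strictlyInverseʳ (e r) a))

satisfying-≡ : ∀ {n} {P : Z3^ n → Bool} {u v} (p : T (P u)) (q : T (P v)) →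
  u ≡ v → (u , p) ≡ (v , q)
satisfying-≡ p q refl = cong (_ ,_) (T-irrelevant p q)

lower : ∀ {x y z} → CatEdge x y z → CatVertex x y z
lower e₁₂    = s₁
lower e₂₃    = s₃
lower (eX i) = leafX i
lower (eY i) = leafY i
lower (eZ i) = leafZ i

lower-injective : ∀ {x y z} → Injective _≡_ _≡_ (lower {x} {y} {z})
lower-injective {_} {_} {_} {e} {e′} eq = trans (sym (above-lower e)) (trans (cong above eq) (above-lower e′))
  where
  above : CatVertex _ _ _ → CatEdge _ _ _
  above s₁        = e₁₂
  above s₂        = e₁₂
  above s₃        = e₂₃
  above (leafX i) = eX i
  above (leafY i) = eY i
  above (leafZ i) = eZ i
  above-lower : ∀ e → above (lower e) ≡ e
  above-lower e₁₂    = refl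
  above-lower e₂₃    = refl
  above-lower (eX i) = refl
  above-lower (eY i) = refl
  above-lower (eZ i) = refl

module FromColouring {k σ s} (C : RainbowColouring k σ s) where
  open RainbowColouring C

  Fibre : Role → Set
  Fibre r = Satisfying (λ u → ⌊ role u ≟ᴿ r ⌋)

  Slot : Role → Set
  Slot (spine _) = ⊤
  Slot (leaf p)  = Fin (s p)

  slots : ∀ r → Slot r ↔ Fibre r
  slots (spine p) = mk↔ₛ′ (λ _ → σ p , fromWitness (spine-at p)) _
    (λ (u , q) → satisfying-≡ _ q (sym (spine-only (toWitness q)))) (λ _ → refl)
  slots (leaf p)  = subst (λ m → Fin m ↔ Fibre (leaf p)) (sizes p) (enumeration _)

  partition : Σ Role Fibre ↔ Z3^ k
  partition = mk↔ₛ′ (λ (_ , u , _) → u) (λ u → role u , u , fromWitness refl) (λ _ → refl) from-to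
    where
    from-to : ∀ w → (role (proj₁ (proj₂ w)) , proj₁ (proj₂ w) , fromWitness refl) ≡ w
    from-to (r , u , q) with toWitness q
    ... | refl = cong (λ q′ → role u , u , q′) (T-irrelevant _ q)

  vertices : Σ Role Slot ↔ CatVertex (s p₁) (s p₂) (s p₃)
  vertices = mk↔ₛ′ to from to-from from-to
    where
    to : Σ Role Slot → CatVertex _ _ _
    to (spine p₁ , _) = s₁
    to (spine p₂ , _) = s₂
    to (spine p₃ , _) = s₃
    to (leaf p₁ , i)  = leafX i
    to (leaf p₂ , i)  = leafY i
    to (leaf p₃ , i)  = leafZ i
    from : CatVertex _ _ _ → Σ Role Slot
    from s₁        = spine p₁ , tt
    from s₂        = spine p₂ , tt
    from s₃        = spine p₃ , tt
    from (leafX i) = leaf p₁ , i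
    from (leafY i) = leaf p₂ , i
    from (leafZ i) = leaf p₃ , i
    to-from : ∀ v → to (from v) ≡ v
    to-from s₁        = refl
    to-from s₂        = refl
    to-from s₃        = refl
    to-from (leafX i) = refl
    to-from (leafY i) = refl
    to-from (leafZ i) = refl
    from-to : ∀ w → from (to w) ≡ w
    from-to (spine p₁ , _) = refl
    from-to (spine p₂ , _) = refl
    from-to (spine p₃ , _) = refl
    from-to (leaf p₁ , _)  = refl
    from-to (leaf p₂ , _)  = refl
    from-to (leaf p₃ , _)  = refl

  labelling : CatVertex (s p₁) (s p₂) (s p₃) ↔ Z3^ k
  labelling = ↔-trans (↔-sym vertices) (↔-trans (Σ-cong slots) partition)

  f : CatVertex (s p₁) (s p₂) (s p₃) → Z3^ k
  f = Inverse.to labelling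

  roleOf : CatVertex (s p₁) (s p₂) (s p₃) → Role
  roleOf v = proj₁ (Inverse.from vertices v)

  role-f : ∀ v → role (f v) ≡ roleOf v
  role-f v = toWitness (proj₂ (Inverse.to (slots (roleOf v)) (proj₂ (Inverse.from vertices v))))

  lower-not-root : ∀ e → role (f (lower e)) ≢ spine p₂
  lower-not-root e eq with trans (sym (role-f (lower e))) eq
  lower-not-root e₁₂    _ | ()
  lower-not-root e₂₃    _ | ()
  lower-not-root (eX i) _ | ()
  lower-not-root (eY i) _ | ()
  lower-not-root (eZ i) _ | ()

  edge-label : ∀ e → f (proj₁ (catEnds e)) ⊕ f (proj₂ (catEnds e)) ≡ edgeAbove σ role (f (lower e))
  edge-label e = trans (via-roleOf e) (cong (λ r → σ (parent r) ⊕ f (lower e)) (sym (role-f (lower e))))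
    where
    via-roleOf : ∀ e → f (proj₁ (catEnds e)) ⊕ f (proj₂ (catEnds e)) ≡ σ (parent (roleOf (lower e))) ⊕ f (lower e)
    via-roleOf e₁₂    = AbelianGroup.comm (ℤ₃^ k) (σ p₁) (σ p₂)
    via-roleOf e₂₃    = refl
    via-roleOf (eX i) = refl
    via-roleOf (eY i) = refl
    via-roleOf (eZ i) = refl

  rainbow : IsRainbow k (catEnds {s p₁} {s p₂} {s p₃})
  rainbow = f , Bijection.bijective (Inverse⇒Bijection labelling) , λ {e} {e′} eq →
    lower-injective (Bijection.injective (Inverse⇒Bijection labelling)
      (edges-distinct (lower-not-root e) (lower-not-root e′)
        (trans (sym (edge-label e)) (trans eq (edge-label e′)))))

-- Small colourings checked by evaluation

∀? : ∀ {n} {P : Z3^ n → Set} → (∀ u → Dec (P u)) → Dec (∀ u → P u)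
∀? {zero}  P? = map′ (λ p → λ { [] → p }) (λ h → h []) (P? [])
∀? {suc n} P? = map′ (λ h → λ { (i ∷ u) → h i u }) (λ h i u → h (i ∷ u)) (all? λ i → ∀? λ u → P? (i ∷ u))

∀ᴾ? : {P : Pos → Set} → (∀ p → Dec (P p)) → Dec (∀ p → P p)
∀ᴾ? P? = map′ (λ (a , b , c) → λ { p₁ → a ; p₂ → b ; p₃ → c }) (λ h → h p₁ , h p₂ , h p₃)
  (P? p₁ ×-dec (P? p₂ ×-dec P? p₃))

_≟ᵛ_ : ∀ {n} → DecidableEquality (Z3^ n)
_≟ᵛ_ = ≡-dec _≟ᶠ_

edgesDistinct? : ∀ {n} (σ : Pos → Z3^ n) (role : Z3^ n → Role) → Dec (EdgesDistinct σ role)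
edgesDistinct? σ role = map′ (λ h {u} {v} → h u v) (λ h u v → h)
  (∀? λ u → ∀? λ v → ¬? (role u ≟ᴿ spine p₂) →-dec (¬? (role v ≟ᴿ spine p₂) →-dec
    (edgeAbove σ role u ≟ᵛ edgeAbove σ role v →-dec u ≟ᵛ v)))

ColouringConditions : ∀ {n} → (Pos → Z3^ n) → Profile → (Z3^ n → Role) → Set
ColouringConditions σ s role = EdgesDistinct σ role × (∀ p → size role (leaf p) ≡ s p)

colouring? : ∀ {n} σ s (role : Z3^ n → Role) → Dec (ColouringConditions σ s role)
colouring? σ s role = edgesDistinct? σ role ×-dec ∀ᴾ? λ p → size role (leaf p) ≟ⁿ s p

leafColouring? : ∀ {n} σ s (role : Z3^ n → Role) →
  Dec (ColouringConditions σ s role × (∀ u p → role u ≢ spine p))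
leafColouring? σ s role = colouring? σ s role ×-dec ∀? λ u → ∀ᴾ? λ p → ¬? (role u ≟ᴿ spine p)

rainbowColouring? : ∀ {n} σ s (role : Z3^ n → Role) →
  Dec (ColouringConditions σ s role × (∀ p → role (σ p) ≡ spine p) × (∀ u p → role u ≡ spine p → u ≡ σ p))
rainbowColouring? σ s role = colouring? σ s role ×-dec
  (∀ᴾ? λ p → role (σ p) ≟ᴿ spine p) ×-dec (∀? λ u → ∀ᴾ? λ p → role u ≟ᴿ spine p →-dec u ≟ᵛ σ p)

Table : ℕ → Set
Table zero    = Role
Table (suc n) = Vec (Table n) 3

roles : ∀ {n} → Table n → Z3^ n → Role
roles r []      = r
roles t (i ∷ u) = roles (lookup t i) u

leafTile : ∀ {n σ s} (t : Table n) → {True (leafColouring? σ s (roles t))} → LeafColouring n σ s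
leafTile t {ok} = let (distinct , sizes) , leaves = toWitness ok in record
  { colouring = record { role = roles t ; edges-distinct = distinct ; sizes = sizes } ; leaves-only = leaves }

rainbowTile : ∀ {n σ s} (t : Table n) → {True (rainbowColouring? σ s (roles t))} → RainbowColouring n σ s
rainbowTile t {ok} = let (distinct , sizes) , at , only = toWitness ok in record
  { colouring = record { role = roles t ; edges-distinct = distinct ; sizes = sizes }
  ; spine-at = at ; spine-only = λ {u} {p} → only u p }

X Y Z S₁ S₂ S₃ : Role
X  = leaf p₁
Y  = leaf p₂
Z  = leaf p₃
S₁ = spine p₁
S₂ = spine p₂
S₃ = spine p₃

_+ᵛ_ : ∀ {d} → Vec ℕ d → Vec ℕ d → Vec ℕ d
_+ᵛ_ = zipWith _+_

split : ∀ {d} (v : Vec ℕ d) a b → sum v ≡ a + b →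
  ∃₂ λ v₁ v₂ → v ≡ v₁ +ᵛ v₂ × sum v₁ ≡ a × sum v₂ ≡ b
split [] a b e = [] , [] , refl , sym (m+n≡0⇒m≡0 a (sym e)) , sym (m+n≡0⇒n≡0 a (sym e))
split v zero b e = replicate _ 0 , v , sym (zipWith-identityˡ (λ _ → refl) v) , sum-zeros v , e
  where
  sum-zeros : ∀ {d} (v : Vec ℕ d) → sum (replicate d 0) ≡ 0
  sum-zeros []      = refl
  sum-zeros (_ ∷ v) = sum-zeros v
split (zero ∷ v) (suc a) b e with split v (suc a) b e
... | v₁ , v₂ , refl , e₁ , e₂ = 0 ∷ v₁ , 0 ∷ v₂ , refl , e₁ , e₂
split (suc h ∷ v) (suc a) b e with split (h ∷ v) a b (suc-injective e)
... | h₁ ∷ v₁ , h₂ ∷ v₂ , refl , e₁ , e₂ = suc h₁ ∷ v₁ , h₂ ∷ v₂ , refl , cong suc e₁ , e₂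

split₃ : ∀ {d} (v : Vec ℕ d) a b c → sum v ≡ a + (b + c) →
  ∃₂ λ v₀ v₁ → ∃ λ v₂ → v ≡ v₀ +ᵛ (v₁ +ᵛ v₂) × sum v₀ ≡ a × sum v₁ ≡ b × sum v₂ ≡ c
split₃ v a b c e with split v a (b + c) e
... | v₀ , w , refl , e₀ , e′ with split w b c e′
...   | v₁ , v₂ , refl , e₁ , e₂ = v₀ , v₁ , v₂ , refl , e₀ , e₁ , e₂

3^suc-split : ∀ n → 3 ^ suc n ≡ 3 ^ n + (3 ^ n + 3 ^ n)
3^suc-split n = cong (λ w → 3 ^ n + (3 ^ n + w)) (+-identityʳ (3 ^ n))

3^≡1+ : ∀ n → ∃ λ w → 3 ^ n ≡ suc w
3^≡1+ zero = 0 , refl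
3^≡1+ (suc n) with 3^≡1+ n
... | w , e = w + (3 ^ n + 3 ^ n) , trans (3^suc-split n) (cong (_+ (3 ^ n + 3 ^ n)) e)

3^suc≡3+ : ∀ n → ∃ λ w → 3 ^ suc n ≡ 3 + w
3^suc≡3+ n with 3^≡1+ n
... | w , e = 3 * w , trans (cong (3 *_) e) (triple-suc w)
  where
  triple-suc : ∀ w → 3 * suc w ≡ 3 + 3 * w
  triple-suc = solve-∀

collinear : ∀ n → Pos → Z3^ (suc n)
collinear zero p₁    = suc zero ∷ []
collinear zero p₂    = zero ∷ []
collinear zero p₃    = suc (suc zero) ∷ []
collinear (suc n)    = lift (collinear n)

-- v counts the blocks of three leaves of each base kind: all at p₁, all at p₂, all at p₃, one at each.
collinearProfile : Vec ℕ 4 → Profile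
collinearProfile (a ∷ b ∷ c ∷ m ∷ []) p₁ = m + 3 * a
collinearProfile (a ∷ b ∷ c ∷ m ∷ []) p₂ = m + 3 * b
collinearProfile (a ∷ b ∷ c ∷ m ∷ []) p₃ = m + 3 * c

collinearProfile-+ : ∀ v₀ v₁ v₂ → ∀ p →
  (collinearProfile v₀ ⊞ collinearProfile v₁ ⊞ collinearProfile v₂) p ≡ collinearProfile (v₀ +ᵛ (v₁ +ᵛ v₂)) p
collinearProfile-+ (a ∷ b ∷ c ∷ m ∷ []) (a′ ∷ b′ ∷ c′ ∷ m′ ∷ []) (a″ ∷ b″ ∷ c″ ∷ m″ ∷ []) = λ
  { p₁ → distrib a a′ a″ m m′ m″ ; p₂ → distrib b b′ b″ m m′ m″ ; p₃ → distrib c c′ c″ m m′ m″ }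
  where
  distrib : ∀ a a′ a″ m m′ m″ → (m + 3 * a) + ((m′ + 3 * a′) + (m″ + 3 * a″)) ≡ (m + (m′ + m″)) + 3 * (a + (a′ + a″))
  distrib = solve-∀

collinear-leaves : ∀ n (v : Vec ℕ 4) → sum v ≡ 3 ^ n → LeafColouring (suc n) (collinear n) (collinearProfile v)
collinear-leaves zero (1 ∷ 0 ∷ 0 ∷ 0 ∷ []) refl = leafTile (X ∷ X ∷ X ∷ [])
collinear-leaves zero (0 ∷ 1 ∷ 0 ∷ 0 ∷ []) refl = leafTile (Y ∷ Y ∷ Y ∷ [])
collinear-leaves zero (0 ∷ 0 ∷ 1 ∷ 0 ∷ []) refl = leafTile (Z ∷ Z ∷ Z ∷ [])
collinear-leaves zero (0 ∷ 0 ∷ 0 ∷ 1 ∷ []) refl = leafTile (X ∷ Z ∷ Y ∷ [])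
collinear-leaves (suc n) v e with split₃ v (3 ^ n) (3 ^ n) (3 ^ n) (trans e (3^suc-split n))
... | v₀ , v₁ , v₂ , refl , e₀ , e₁ , e₂ = resize-leaves (collinearProfile-+ v₀ v₁ v₂)
  (stack-leaves (collinear-leaves n v₀ e₀) (collinear-leaves n v₁ e₁) (collinear-leaves n v₂ e₂))

collinear-rainbow : ∀ n (v : Vec ℕ 4) → suc (sum v) ≡ 3 ^ n → RainbowColouring (suc n) (collinear n) (collinearProfile v)
collinear-rainbow zero (0 ∷ 0 ∷ 0 ∷ 0 ∷ []) refl = rainbowTile (S₂ ∷ S₁ ∷ S₃ ∷ [])
collinear-rainbow (suc n) v e with 3^≡1+ n
... | w , 3ⁿ≡1+w with split₃ v w (3 ^ n) (3 ^ n)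
      (suc-injective (trans e (trans (3^suc-split n) (cong (_+ (3 ^ n + 3 ^ n)) 3ⁿ≡1+w))))
... | v₀ , v₁ , v₂ , refl , e₀ , e₁ , e₂ = resize-rainbow (collinearProfile-+ v₀ v₁ v₂)
  (stack-rainbow (collinear-rainbow n v₀ (trans (cong suc e₀) (sym 3ⁿ≡1+w)))
                 (collinear-leaves n v₁ e₁) (collinear-leaves n v₂ e₂))

skew : ∀ n → Pos → Z3^ (suc (suc n))
skew zero p₁ = suc zero ∷ zero ∷ []
skew zero p₂ = zero ∷ zero ∷ []
skew zero p₃ = zero ∷ suc zero ∷ []
skew (suc n) = lift (skew n)

skewProfile : Vec ℕ 3 → Profile
skewProfile (a ∷ b ∷ c ∷ []) p₁ = 3 * a
skewProfile (a ∷ b ∷ c ∷ []) p₂ = 3 * b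
skewProfile (a ∷ b ∷ c ∷ []) p₃ = 3 * c

skewProfile-+ : ∀ (β : Profile) v₀ v₁ v₂ → ∀ p →
  ((β ⊞ skewProfile v₀) ⊞ skewProfile v₁ ⊞ skewProfile v₂) p ≡ (β ⊞ skewProfile (v₀ +ᵛ (v₁ +ᵛ v₂))) p
skewProfile-+ β (a ∷ b ∷ c ∷ []) (a′ ∷ b′ ∷ c′ ∷ []) (a″ ∷ b″ ∷ c″ ∷ []) = λ
  { p₁ → distrib (β p₁) a a′ a″ ; p₂ → distrib (β p₂) b b′ b″ ; p₃ → distrib (β p₃) c c′ c″ }
  where
  distrib : ∀ m a a′ a″ → (m + 3 * a) + (3 * a′ + 3 * a″) ≡ m + 3 * (a + (a′ + a″))
  distrib = solve-∀

skew-leaves : ∀ n (v : Vec ℕ 3) → sum v ≡ 3 ^ suc n → LeafColouring (suc (suc n)) (skew n) (skewProfile v)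
skew-leaves zero (0 ∷ 0 ∷ 3 ∷ []) refl = leafTile ((Z ∷ Z ∷ Z ∷ []) ∷ (Z ∷ Z ∷ Z ∷ []) ∷ (Z ∷ Z ∷ Z ∷ []) ∷ [])
skew-leaves zero (0 ∷ 1 ∷ 2 ∷ []) refl = leafTile ((Y ∷ Y ∷ Y ∷ []) ∷ (Z ∷ Z ∷ Z ∷ []) ∷ (Z ∷ Z ∷ Z ∷ []) ∷ [])
skew-leaves zero (0 ∷ 2 ∷ 1 ∷ []) refl = leafTile ((Y ∷ Y ∷ Y ∷ []) ∷ (Y ∷ Y ∷ Y ∷ []) ∷ (Z ∷ Z ∷ Z ∷ []) ∷ [])
skew-leaves zero (0 ∷ 3 ∷ 0 ∷ []) refl = leafTile ((Y ∷ Y ∷ Y ∷ []) ∷ (Y ∷ Y ∷ Y ∷ []) ∷ (Y ∷ Y ∷ Y ∷ []) ∷ [])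
skew-leaves zero (1 ∷ 0 ∷ 2 ∷ []) refl = leafTile ((X ∷ Z ∷ Z ∷ []) ∷ (Z ∷ Z ∷ X ∷ []) ∷ (Z ∷ X ∷ Z ∷ []) ∷ [])
skew-leaves zero (1 ∷ 1 ∷ 1 ∷ []) refl = leafTile ((X ∷ Y ∷ Y ∷ []) ∷ (Z ∷ X ∷ Y ∷ []) ∷ (X ∷ Z ∷ Z ∷ []) ∷ [])
skew-leaves zero (1 ∷ 2 ∷ 0 ∷ []) refl = leafTile ((X ∷ Y ∷ Y ∷ []) ∷ (X ∷ Y ∷ Y ∷ []) ∷ (X ∷ Y ∷ Y ∷ []) ∷ [])
skew-leaves zero (2 ∷ 0 ∷ 1 ∷ []) refl = leafTile ((X ∷ X ∷ Z ∷ []) ∷ (X ∷ Z ∷ X ∷ []) ∷ (Z ∷ X ∷ X ∷ []) ∷ [])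
skew-leaves zero (2 ∷ 1 ∷ 0 ∷ []) refl = leafTile ((X ∷ X ∷ Y ∷ []) ∷ (X ∷ X ∷ Y ∷ []) ∷ (X ∷ X ∷ Y ∷ []) ∷ [])
skew-leaves zero (3 ∷ 0 ∷ 0 ∷ []) refl = leafTile ((X ∷ X ∷ X ∷ []) ∷ (X ∷ X ∷ X ∷ []) ∷ (X ∷ X ∷ X ∷ []) ∷ [])
skew-leaves (suc n) v e with split₃ v (3 ^ suc n) (3 ^ suc n) (3 ^ suc n) (trans e (3^suc-split (suc n)))
... | v₀ , v₁ , v₂ , refl , e₀ , e₁ , e₂ = resize-leaves (skewProfile-+ (λ _ → 0) v₀ v₁ v₂)
  (stack-leaves (skew-leaves n v₀ e₀) (skew-leaves n v₁ e₁) (skew-leaves n v₂ e₂))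

⟨_,_,_⟩ : ℕ → ℕ → ℕ → Profile
⟨ x , y , z ⟩ p₁ = x
⟨ x , y , z ⟩ p₂ = y
⟨ x , y , z ⟩ p₃ = z

-- Every admissible skew leaf count exceeds one of these by multiples of 3.
data Base : Set where
  β₀₂₄ β₀₅₁ β₃₂₁ β₄₂₀ β₁₅₀ β₁₂₃ β₁₃₂ β₂₃₁ : Base

baseProfile : Base → Profile
baseProfile β₀₂₄ = ⟨ 0 , 2 , 4 ⟩
baseProfile β₀₅₁ = ⟨ 0 , 5 , 1 ⟩
baseProfile β₃₂₁ = ⟨ 3 , 2 , 1 ⟩
baseProfile β₄₂₀ = ⟨ 4 , 2 , 0 ⟩
baseProfile β₁₅₀ = ⟨ 1 , 5 , 0 ⟩
baseProfile β₁₂₃ = ⟨ 1 , 2 , 3 ⟩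
baseProfile β₁₃₂ = ⟨ 1 , 3 , 2 ⟩
baseProfile β₂₃₁ = ⟨ 2 , 3 , 1 ⟩

skew-rainbow : ∀ n β (v : Vec ℕ 3) → 3 + sum v ≡ 3 ^ suc n →
  RainbowColouring (suc (suc n)) (skew n) (baseProfile β ⊞ skewProfile v)
skew-rainbow zero β₀₂₄ (0 ∷ 0 ∷ 0 ∷ []) refl = rainbowTile ((S₂ ∷ S₃ ∷ Z ∷ []) ∷ (S₁ ∷ Y ∷ Y ∷ []) ∷ (Z ∷ Z ∷ Z ∷ []) ∷ [])
skew-rainbow zero β₀₅₁ (0 ∷ 0 ∷ 0 ∷ []) refl = rainbowTile ((S₂ ∷ S₃ ∷ Z ∷ []) ∷ (S₁ ∷ Y ∷ Y ∷ []) ∷ (Y ∷ Y ∷ Y ∷ []) ∷ [])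
skew-rainbow zero β₃₂₁ (0 ∷ 0 ∷ 0 ∷ []) refl = rainbowTile ((S₂ ∷ S₃ ∷ X ∷ []) ∷ (S₁ ∷ Y ∷ X ∷ []) ∷ (X ∷ Y ∷ Z ∷ []) ∷ [])
skew-rainbow zero β₄₂₀ (0 ∷ 0 ∷ 0 ∷ []) refl = rainbowTile ((S₂ ∷ S₃ ∷ X ∷ []) ∷ (S₁ ∷ Y ∷ X ∷ []) ∷ (X ∷ Y ∷ X ∷ []) ∷ [])
skew-rainbow zero β₁₅₀ (0 ∷ 0 ∷ 0 ∷ []) refl = rainbowTile ((S₂ ∷ S₃ ∷ Y ∷ []) ∷ (S₁ ∷ Y ∷ Y ∷ []) ∷ (X ∷ Y ∷ Y ∷ []) ∷ [])
skew-rainbow zero β₁₂₃ (0 ∷ 0 ∷ 0 ∷ []) refl = rainbowTile ((S₂ ∷ S₃ ∷ Z ∷ []) ∷ (S₁ ∷ Y ∷ Y ∷ []) ∷ (Z ∷ Z ∷ X ∷ []) ∷ [])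
skew-rainbow zero β₁₃₂ (0 ∷ 0 ∷ 0 ∷ []) refl = rainbowTile ((S₂ ∷ S₃ ∷ Y ∷ []) ∷ (S₁ ∷ Y ∷ Y ∷ []) ∷ (X ∷ Z ∷ Z ∷ []) ∷ [])
skew-rainbow zero β₂₃₁ (0 ∷ 0 ∷ 0 ∷ []) refl = rainbowTile ((S₂ ∷ S₃ ∷ Y ∷ []) ∷ (S₁ ∷ Y ∷ X ∷ []) ∷ (X ∷ Y ∷ Z ∷ []) ∷ [])
skew-rainbow (suc n) β v e with 3^suc≡3+ n
... | w , 3ⁿ⁺¹≡3+w with split₃ v w (3 ^ suc n) (3 ^ suc n)
      (suc-injective (suc-injective (suc-injective
        (trans e (trans (3^suc-split (suc n)) (cong (_+ (3 ^ suc n + 3 ^ suc n)) 3ⁿ⁺¹≡3+w))))))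
... | v₀ , v₁ , v₂ , refl , e₀ , e₁ , e₂ = resize-rainbow (skewProfile-+ (baseProfile β) v₀ v₁ v₂)
  (stack-rainbow (skew-rainbow n β v₀ (trans (cong (3 +_) e₀) (sym 3ⁿ⁺¹≡3+w)))
                 (skew-leaves n v₁ e₁) (skew-leaves n v₂ e₂))

module Sums (k : ℕ) where
  open AbelianGroup (ℤ₃^ k) public
    using (assoc; comm; identityˡ; identityʳ; inverseʳ; group; commutativeMonoid; monoid)
  open import Algebra.Properties.Group group public using (∙-cancelˡ; ∙-cancelʳ)
  open import Algebra.Properties.CommutativeMonoid.Sum commutativeMonoid public
    using (sum-permute; sum-cong-≗; ∑-distrib-+; sum-replicate) renaming (sum to ∑)
  open import Algebra.Properties.Monoid.Mult monoid public
    using (×-homo-+; ×-assocˡ) renaming (_×_ to _·_)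

  triple : ∀ (u : Z3^ k) → u ⊕ (u ⊕ u) ≡ 0ᵛ
  triple u = trans (cong (u ⊕_) (double u)) (inverseʳ u)
    where
    double : ∀ {n} (u : Z3^ n) → u ⊕ u ≡ map -₃_ u
    double []      = refl
    double (_ ∷ u) = cong (_ ∷_) (double u)

  ·-zero : ∀ q → q · 0ᵛ ≡ 0ᵛ
  ·-zero zero    = refl
  ·-zero (suc q) = trans (identityˡ _) (·-zero q)

  ·-%3 : ∀ n u → n · u ≡ (n % 3) · u
  ·-%3 n u = begin
    n · u                                  ≡⟨ cong (_· u) (m≡m%n+[m/n]*n n 3) ⟩
    (n % 3 + n / 3 * 3) · u                ≡⟨ ×-homo-+ u (n % 3) (n / 3 * 3) ⟩
    ((n % 3) · u) ⊕ ((n / 3 * 3) · u)      ≡⟨ cong (((n % 3) · u) ⊕_) (sym (×-assocˡ u (n / 3) 3)) ⟩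
    ((n % 3) · u) ⊕ ((n / 3) · (3 · u))    ≡⟨ cong (λ w → ((n % 3) · u) ⊕ ((n / 3) · w)) three-u ⟩
    ((n % 3) · u) ⊕ ((n / 3) · 0ᵛ)         ≡⟨ cong (((n % 3) · u) ⊕_) (·-zero (n / 3)) ⟩
    ((n % 3) · u) ⊕ 0ᵛ                     ≡⟨ identityʳ _ ⟩
    (n % 3) · u                            ∎
    where
    open ≡-Reasoning
    three-u : 3 · u ≡ 0ᵛ
    three-u = trans (cong (λ w → u ⊕ (u ⊕ w)) (identityʳ u)) (triple u)

  sum-splitAt : ∀ m {n} (h : Fin m ⊎ Fin n → Z3^ k) → ∑ (h ∘ splitAt m) ≡ ∑ (h ∘ inj₁) ⊕ ∑ (h ∘ inj₂)
  sum-splitAt zero    h = sym (identityˡ _)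
  sum-splitAt (suc m) h = trans (cong (h (inj₁ zero) ⊕_) (sum-splitAt m (h ∘ map₁ suc)))
                                (sym (assoc _ _ _))

  injective⇒surjective : ∀ {n} (σ : Fin n → Fin n) → Injective _≡_ _≡_ σ → ∀ j → ∃ λ i → σ i ≡ j
  injective⇒surjective {suc n} σ σ-inj j with any? (λ i → σ i ≟ᶠ j)
  ... | yes hit = hit
  ... | no miss = ⊥-elim (1+n≰n (injective⇒≤ {f = avoid} avoid-injective))
    where
    avoid : Fin (suc n) → Fin n
    avoid i = punchOut {i = j} (λ e → miss (i , sym e))
    avoid-injective : Injective _≡_ _≡_ avoid
    avoid-injective {i} {i′} e = σ-inj (punchOut-injective (λ e′ → miss (i , sym e′)) (λ e′ → miss (i′ , sym e′)) e)

  sum-reindex : ∀ {n} (g : Fin n → Z3^ k) (σ : Fin n → Fin n) → Injective _≡_ _≡_ σ → ∑ (g ∘ σ) ≡ ∑ g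
  sum-reindex g σ σ-inj =
    sym (sum-permute g (permutation σ σ⁻¹ (λ j → proj₂ (onto j)) (λ i → σ-inj (proj₂ (onto (σ i))))))
    where
    onto = injective⇒surjective σ σ-inj
    σ⁻¹ = λ j → proj₁ (onto j)

  missing-label : ∀ {n} (F : Fin (suc n) → Z3^ k) (L : Fin n → Z3^ k) →
    Injective _≡_ _≡_ F → (∀ u → ∃ λ i → F i ≡ u) → Injective _≡_ _≡_ L →
    ∃ λ m → (∀ j → L j ≢ m) × ∑ F ≡ m ⊕ ∑ L
  missing-label {n} F L F-inj F-onto L-inj = m , missing , (begin
    ∑ F        ≡⟨ sym (sum-reindex F π π-inj) ⟩
    ∑ (F ∘ π)  ≡⟨ sum-cong-≗ Fπ ⟩
    ∑ Λ        ∎)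
    where
    open ≡-Reasoning
    unlabelled : ∃ λ i → ¬ ∃ λ j → L j ≡ F i
    unlabelled = ¬∀⟶∃¬ (suc n) _ (λ i → any? λ j → L j ≟ᵛ F i) λ labelled →
      1+n≰n (injective⇒≤ {f = λ i → proj₁ (labelled i)} λ {i} {i′} e →
        F-inj (trans (sym (proj₂ (labelled i))) (trans (cong L e) (proj₂ (labelled i′)))))
    m = F (proj₁ unlabelled)
    missing : ∀ j → L j ≢ m
    missing j e = proj₂ unlabelled (j , e)
    Λ : Fin (suc n) → Z3^ k
    Λ zero    = m
    Λ (suc j) = L j
    Λ-inj : Injective _≡_ _≡_ Λ
    Λ-inj {zero}  {zero}  _ = refl
    Λ-inj {zero}  {suc j} e = ⊥-elim (missing j (sym e))
    Λ-inj {suc i} {zero}  e = ⊥-elim (missing i e)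
    Λ-inj {suc i} {suc j} e = cong suc (L-inj e)
    π : Fin (suc n) → Fin (suc n)
    π i = proj₁ (F-onto (Λ i))
    Fπ : ∀ i → F (π i) ≡ Λ i
    Fπ i = proj₂ (F-onto (Λ i))
    π-inj : Injective _≡_ _≡_ π
    π-inj {i} {j} e = Λ-inj (trans (sym (Fπ i)) (trans (cong F e) (Fπ j)))

-- Necessity

edgeParts : ∀ {x y z} → (Fin 2 ⊎ (Fin x ⊎ (Fin y ⊎ Fin z))) ↔ CatEdge x y z
edgeParts {x} {y} {z} = mk↔ₛ′ to from to-from from-to
  where
  to : Fin 2 ⊎ (Fin x ⊎ (Fin y ⊎ Fin z)) → CatEdge x y z
  to (inj₁ zero)              = e₁₂
  to (inj₁ (suc zero))        = e₂₃
  to (inj₂ (inj₁ i))          = eX i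
  to (inj₂ (inj₂ (inj₁ i)))   = eY i
  to (inj₂ (inj₂ (inj₂ i)))   = eZ i
  from : CatEdge x y z → Fin 2 ⊎ (Fin x ⊎ (Fin y ⊎ Fin z))
  from e₁₂    = inj₁ zero
  from e₂₃    = inj₁ (suc zero)
  from (eX i) = inj₂ (inj₁ i)
  from (eY i) = inj₂ (inj₂ (inj₁ i))
  from (eZ i) = inj₂ (inj₂ (inj₂ i))
  to-from : ∀ e → to (from e) ≡ e
  to-from e₁₂    = refl
  to-from e₂₃    = refl
  to-from (eX i) = refl
  to-from (eY i) = refl
  to-from (eZ i) = refl
  from-to : ∀ w → from (to w) ≡ w
  from-to (inj₁ zero)            = refl
  from-to (inj₁ (suc zero))      = refl
  from-to (inj₂ (inj₁ i))        = refl
  from-to (inj₂ (inj₂ (inj₁ i))) = refl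
  from-to (inj₂ (inj₂ (inj₂ i))) = refl

edgeEnum : ∀ {x y z} → Fin (2 + (x + (y + z))) ↔ CatEdge x y z
edgeEnum = ↔-trans +↔⊎ (↔-trans (↔-refl ⊎-↔ (↔-trans +↔⊎ (↔-refl ⊎-↔ +↔⊎))) edgeParts)

vertexAt : ∀ {x y z} → Fin (3 + (x + (y + z))) → CatVertex x y z
vertexAt zero    = s₂
vertexAt (suc i) = lower (Inverse.to edgeEnum i)

vertexAt-injective : ∀ {x y z} → Injective _≡_ _≡_ (vertexAt {x} {y} {z})
vertexAt-injective {_} {_} {_} {zero}  {zero}  _ = refl
vertexAt-injective {_} {_} {_} {zero}  {suc j} e = ⊥-elim (lower≢s₂ _ (sym e))
  where
  lower≢s₂ : ∀ e → lower e ≢ s₂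
  lower≢s₂ e₁₂ ()
  lower≢s₂ e₂₃ ()
  lower≢s₂ (eX _) ()
  lower≢s₂ (eY _) ()
  lower≢s₂ (eZ _) ()
vertexAt-injective {_} {_} {_} {suc i} {zero}  e = sym (vertexAt-injective (sym e))
vertexAt-injective {_} {_} {_} {suc i} {suc j} e =
  cong suc (Injection.injective (Inverse⇒Injection edgeEnum) (lower-injective e))

lower-hit : ∀ {x y z} (e : CatEdge x y z) → ∃ λ i → vertexAt i ≡ lower e
lower-hit e = suc (Inverse.from edgeEnum e) , cong lower (Inverse.strictlyInverseˡ edgeEnum e)

vertexAt-surjective : ∀ {x y z} (v : CatVertex x y z) → ∃ λ i → vertexAt i ≡ v
vertexAt-surjective s₂        = zero , refl
vertexAt-surjective s₁        = lower-hit e₁₂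
vertexAt-surjective s₃        = lower-hit e₂₃
vertexAt-surjective (leafX i) = lower-hit (eX i)
vertexAt-surjective (leafY i) = lower-hit (eY i)
vertexAt-surjective (leafZ i) = lower-hit (eZ i)

module Labelling {k x y z} (f : CatVertex x y z → Z3^ k) (rainbow : IsRainbowLabeling k (catEnds {x} {y} {z}) f) where
  open Sums k
  open import Algebra.Solver.CommutativeMonoid commutativeMonoid using (solve; _⊜_; id) renaming (_⊕_ to _⊹_)

  a b c : Z3^ k
  a = f s₁
  b = f s₂
  c = f s₃

  ℓ : CatEdge x y z → Z3^ k
  ℓ e = f (proj₁ (catEnds e)) ⊕ f (proj₂ (catEnds e))

  f-injective : Injective _≡_ _≡_ f
  f-injective = proj₁ (proj₁ rainbow)

  preimage : ∀ u → ∃ λ v → f v ≡ u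
  preimage u = proj₁ (proj₂ (proj₁ rainbow) u) , proj₂ (proj₂ (proj₁ rainbow) u) refl

  ℓ-injective : Injective _≡_ _≡_ ℓ
  ℓ-injective = proj₂ rainbow

  sum-edges : (h : CatEdge x y z → Z3^ k) →
    ∑ (h ∘ Inverse.to edgeEnum) ≡ (h e₁₂ ⊕ (h e₂₃ ⊕ 0ᵛ)) ⊕ (∑ (h ∘ eX) ⊕ (∑ (h ∘ eY) ⊕ ∑ (h ∘ eZ)))
  sum-edges h =
    trans (sum-splitAt 2 (h ∘ Inverse.to (↔-trans (↔-refl ⊎-↔ (↔-trans +↔⊎ (↔-refl ⊎-↔ +↔⊎))) edgeParts)))
      (cong ((h e₁₂ ⊕ (h e₂₃ ⊕ 0ᵛ)) ⊕_)
        (trans (sum-splitAt x (h ∘ Inverse.to edgeParts ∘ inj₂ ∘ Inverse.to (↔-refl ⊎-↔ +↔⊎)))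
          (cong (∑ (h ∘ eX) ⊕_) (sum-splitAt y (h ∘ Inverse.to edgeParts ∘ inj₂ ∘ inj₂)))))

  spoke : ∀ {n} (u : Z3^ k) (g : Fin n → Z3^ k) → ∑ (λ i → u ⊕ g i) ≡ (n · u) ⊕ ∑ g
  spoke {n} u g = trans (∑-distrib-+ (λ _ → u) g) (cong (_⊕ ∑ g) (sum-replicate n))

  vertexLabels-injective : Injective _≡_ _≡_ (f ∘ vertexAt)
  vertexLabels-injective e = vertexAt-injective (f-injective e)

  vertexLabels-surjective : ∀ u → ∃ λ i → f (vertexAt i) ≡ u
  vertexLabels-surjective u with preimage u
  ... | v , fv≡u with vertexAt-surjective v
  ... | i , vi≡v = i , trans (cong f vi≡v) fv≡u

  edgeLabels-injective : Injective _≡_ _≡_ (ℓ ∘ Inverse.to edgeEnum)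
  edgeLabels-injective e = Injection.injective (Inverse⇒Injection edgeEnum) (ℓ-injective e)

  degree-sum : ∃ λ m → (∀ e → ℓ e ≢ m) × m ⊕ (b ⊕ ((x · a) ⊕ ((y · b) ⊕ (z · c)))) ≡ 0ᵛ
  degree-sum = m , missing , ∙-cancelʳ V _ _ (begin
    D ⊕ V                                  ≡⟨ regroup m a b c (x · a) (y · b) (z · c) ΣX ΣY ΣZ ⟩
    m ⊕ E                                  ≡⟨ cong (m ⊕_) (sym edges≡) ⟩
    m ⊕ ∑ (ℓ ∘ Inverse.to edgeEnum)        ≡⟨ sym vertices≡ ⟩
    ∑ (f ∘ vertexAt)                       ≡⟨ cong (b ⊕_) (sum-edges (f ∘ lower)) ⟩
    V                                      ≡⟨ sym (identityˡ V) ⟩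
    0ᵛ ⊕ V                                 ∎)
    where
    open ≡-Reasoning
    labels = missing-label (f ∘ vertexAt) (ℓ ∘ Inverse.to edgeEnum)
      vertexLabels-injective vertexLabels-surjective edgeLabels-injective
    m = proj₁ labels
    vertices≡ : ∑ (f ∘ vertexAt) ≡ m ⊕ ∑ (ℓ ∘ Inverse.to edgeEnum)
    vertices≡ = proj₂ (proj₂ labels)
    missing : ∀ e → ℓ e ≢ m
    missing e ℓe≡m = proj₁ (proj₂ labels) (Inverse.from edgeEnum e)
      (trans (cong ℓ (Inverse.strictlyInverseˡ edgeEnum e)) ℓe≡m)
    ΣX = ∑ (f ∘ leafX)
    ΣY = ∑ (f ∘ leafY)
    ΣZ = ∑ (f ∘ leafZ)
    D = m ⊕ (b ⊕ ((x · a) ⊕ ((y · b) ⊕ (z · c))))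
    V = b ⊕ ((a ⊕ (c ⊕ 0ᵛ)) ⊕ (ΣX ⊕ (ΣY ⊕ ΣZ)))
    E = ((a ⊕ b) ⊕ ((b ⊕ c) ⊕ 0ᵛ)) ⊕ (((x · a) ⊕ ΣX) ⊕ (((y · b) ⊕ ΣY) ⊕ ((z · c) ⊕ ΣZ)))
    edges≡ : ∑ (ℓ ∘ Inverse.to edgeEnum) ≡ E
    edges≡ = trans (sum-edges ℓ) (cong (((a ⊕ b) ⊕ ((b ⊕ c) ⊕ 0ᵛ)) ⊕_)
      (cong₂ _⊕_ (spoke a (f ∘ leafX)) (cong₂ _⊕_ (spoke b (f ∘ leafY)) (spoke c (f ∘ leafZ)))))
    regroup = solve 10 (λ m a b c xa yb zc X Y Z →
      (m ⊹ (b ⊹ (xa ⊹ (yb ⊹ zc)))) ⊹ (b ⊹ ((a ⊹ (c ⊹ id)) ⊹ (X ⊹ (Y ⊹ Z)))) ⊜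
      m ⊹ (((a ⊹ b) ⊹ ((b ⊹ c) ⊹ id)) ⊹ ((xa ⊹ X) ⊹ ((yb ⊹ Y) ⊹ (zc ⊹ Z))))) refl

  ·-residue : ∀ n {r} u → n % 3 ≡ r → n · u ≡ r · u
  ·-residue n u e = trans (·-%3 n u) (cong (_· u) e)

  -- With residues (0, 1, 2) the missing label is b ⊕ c, the label of e₂₃.
  no-residues-0-1-2 : x % 3 ≡ 0 → y % 3 ≡ 1 → z % 3 ≡ 2 → ⊥
  no-residues-0-1-2 x0 y1 z2 = missing e₂₃ (∙-cancelʳ W _ _ (trans bc⊕W (sym m⊕W)))
    where
    m = proj₁ degree-sum
    missing = proj₁ (proj₂ degree-sum)
    D = proj₂ (proj₂ degree-sum)
    W = b ⊕ (0ᵛ ⊕ ((b ⊕ 0ᵛ) ⊕ (c ⊕ (c ⊕ 0ᵛ))))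
    m⊕W : m ⊕ W ≡ 0ᵛ
    m⊕W = trans (sym (cong (λ w → m ⊕ (b ⊕ w))
      (cong₂ _⊕_ (·-residue x a x0) (cong₂ _⊕_ (·-residue y b y1) (·-residue z c z2))))) D
    bc⊕W : (b ⊕ c) ⊕ W ≡ 0ᵛ
    bc⊕W = begin
      (b ⊕ c) ⊕ W                        ≡⟨ solve 2 (λ b c → (b ⊹ c) ⊹ (b ⊹ (id ⊹ ((b ⊹ id) ⊹ (c ⊹ (c ⊹ id)))))
                                                     ⊜ (b ⊹ (b ⊹ b)) ⊹ (c ⊹ (c ⊹ c))) refl b c ⟩
      (b ⊕ (b ⊕ b)) ⊕ (c ⊕ (c ⊕ c))      ≡⟨ cong₂ _⊕_ (triple b) (triple c) ⟩
      0ᵛ ⊕ 0ᵛ                            ≡⟨ identityˡ 0ᵛ ⟩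
      0ᵛ                                 ∎
      where open ≡-Reasoning

  -- With residues (2, 1, 0) the missing label is a ⊕ b, the label of e₁₂.
  no-residues-2-1-0 : x % 3 ≡ 2 → y % 3 ≡ 1 → z % 3 ≡ 0 → ⊥
  no-residues-2-1-0 x2 y1 z0 = missing e₁₂ (∙-cancelʳ W _ _ (trans ab⊕W (sym m⊕W)))
    where
    m = proj₁ degree-sum
    missing = proj₁ (proj₂ degree-sum)
    D = proj₂ (proj₂ degree-sum)
    W = b ⊕ ((a ⊕ (a ⊕ 0ᵛ)) ⊕ ((b ⊕ 0ᵛ) ⊕ 0ᵛ))
    m⊕W : m ⊕ W ≡ 0ᵛ
    m⊕W = trans (sym (cong (λ w → m ⊕ (b ⊕ w))
      (cong₂ _⊕_ (·-residue x a x2) (cong₂ _⊕_ (·-residue y b y1) (·-residue z c z0))))) D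
    ab⊕W : (a ⊕ b) ⊕ W ≡ 0ᵛ
    ab⊕W = begin
      (a ⊕ b) ⊕ W                        ≡⟨ solve 2 (λ a b → (a ⊹ b) ⊹ (b ⊹ ((a ⊹ (a ⊹ id)) ⊹ ((b ⊹ id) ⊹ id)))
                                                     ⊜ (a ⊹ (a ⊹ a)) ⊹ (b ⊹ (b ⊹ b))) refl a b ⟩
      (a ⊕ (a ⊕ a)) ⊕ (b ⊕ (b ⊕ b))      ≡⟨ cong₂ _⊕_ (triple a) (triple b) ⟩
      0ᵛ ⊕ 0ᵛ                            ≡⟨ identityˡ 0ᵛ ⟩
      0ᵛ                                 ∎
      where open ≡-Reasoning

-- Without leaves at s₂, translation by t = a - c maps the labels of X to labels of X.
module Translation {k x z} (f : CatVertex x 0 z → Z3^ k) (rainbow : IsRainbowLabeling k (catEnds {x} {0} {z}) f) where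
  open Sums k
  open Labelling f rainbow
  open import Algebra.Solver.CommutativeMonoid commutativeMonoid using (solve; _⊜_; id) renaming (_⊕_ to _⊹_)

  t : Z3^ k
  t = a ⊕ (c ⊕ c)

  c⊕t≡a : c ⊕ t ≡ a
  c⊕t≡a = trans (solve 2 (λ a c → c ⊹ (a ⊹ (c ⊹ c)) ⊜ a ⊹ (c ⊹ (c ⊹ c))) refl a c)
                (trans (cong (a ⊕_) (triple c)) (identityʳ a))

  t-thrice : ∀ u → ((u ⊕ t) ⊕ t) ⊕ t ≡ u
  t-thrice u = trans (solve 2 (λ u t → ((u ⊹ t) ⊹ t) ⊹ t ⊜ u ⊹ (t ⊹ (t ⊹ t))) refl u t)
                     (trans (cong (u ⊕_) (triple t)) (identityʳ u))

  near₁ : Maybe (Fin x) → CatVertex x 0 z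
  near₁ nothing  = s₂
  near₁ (just i) = leafX i

  near₃ : Maybe (Fin z) → CatVertex x 0 z
  near₃ nothing  = s₂
  near₃ (just j) = leafZ j

  edge₁ : Maybe (Fin x) → CatEdge x 0 z
  edge₁ nothing  = e₁₂
  edge₁ (just i) = eX i

  edge₃ : Maybe (Fin z) → CatEdge x 0 z
  edge₃ nothing  = e₂₃
  edge₃ (just j) = eZ j

  ℓ-edge₁ : ∀ o → ℓ (edge₁ o) ≡ a ⊕ f (near₁ o)
  ℓ-edge₁ nothing  = refl
  ℓ-edge₁ (just i) = refl

  ℓ-edge₃ : ∀ o → ℓ (edge₃ o) ≡ c ⊕ f (near₃ o)
  ℓ-edge₃ nothing  = comm b c
  ℓ-edge₃ (just j) = refl

  edge₁≢edge₃ : ∀ o o′ → edge₁ o ≢ edge₃ o′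
  edge₁≢edge₃ nothing  nothing  ()
  edge₁≢edge₃ nothing  (just _) ()
  edge₁≢edge₃ (just _) nothing  ()
  edge₁≢edge₃ (just _) (just _) ()

  -- a ⊕ u and c ⊕ (u ⊕ t) are the same label, carried by an edge at s₁ and an edge at s₃.
  no-crossing : ∀ o o′ → f (near₁ o) ⊕ t ≢ f (near₃ o′)
  no-crossing o o′ e = edge₁≢edge₃ o o′ (ℓ-injective (begin
    ℓ (edge₁ o)                 ≡⟨ ℓ-edge₁ o ⟩
    a ⊕ u                       ≡⟨ cong (_⊕ u) (sym c⊕t≡a) ⟩
    (c ⊕ t) ⊕ u                 ≡⟨ solve 3 (λ c t u → (c ⊹ t) ⊹ u ⊜ c ⊹ (u ⊹ t)) refl c t u ⟩
    c ⊕ (u ⊕ t)                 ≡⟨ cong (c ⊕_) e ⟩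
    c ⊕ f (near₃ o′)            ≡⟨ sym (ℓ-edge₃ o′) ⟩
    ℓ (edge₃ o′)                ∎))
    where
    open ≡-Reasoning
    u = f (near₁ o)

  data Landing (u : Z3^ k) : Set where
    at-a    : u ≡ a → Landing u
    at-c    : u ≡ c → Landing u
    at-leaf : ∀ j → u ≡ f (leafX j) → Landing u

  landing : ∀ o → Landing (f (near₁ o) ⊕ t)
  landing o with preimage (f (near₁ o) ⊕ t)
  ... | s₁ ,      e = at-a (sym e)
  ... | s₂ ,      e = ⊥-elim (no-crossing o nothing (sym e))
  ... | s₃ ,      e = at-c (sym e)
  ... | leafX j , e = at-leaf j (sym e)
  ... | leafZ j , e = ⊥-elim (no-crossing o (just j) (sym e))

  distinct : ∀ {v w} → f v ≡ f w → v ≢ w → ⊥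
  distinct e v≢w = v≢w (f-injective e)

  never-b : ∀ o → f (near₁ o) ⊕ t ≢ b
  never-b o e with landing o
  ... | at-a e′      = distinct (trans (sym e) e′) λ ()
  ... | at-c e′      = distinct (trans (sym e) e′) λ ()
  ... | at-leaf _ e′ = distinct (trans (sym e) e′) λ ()

  -- Following the translates of b along leaves of X: b, b ⊕ t, b ⊕ 2t, b ⊕ 3t = b.
  b⊕t≡c : b ⊕ t ≡ c
  b⊕t≡c with landing nothing
  ... | at-a e = ⊥-elim (distinct (∙-cancelʳ t _ _ (trans e (sym c⊕t≡a))) λ ())
  ... | at-c e = e
  ... | at-leaf j e with landing (just j)
  ...   | at-a e′ = ∙-cancelʳ t _ _ (trans (cong (_⊕ t) e) (trans e′ (sym c⊕t≡a)))
  ...   | at-c e′ = ⊥-elim (distinct (trans (sym (t-thrice b)) (trans (cong (λ w → (w ⊕ t) ⊕ t) e)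
                      (trans (cong (_⊕ t) e′) c⊕t≡a))) λ ())
  ...   | at-leaf l e′ = ⊥-elim (never-b (just l)
                        (sym (trans (sym (t-thrice b)) (cong (_⊕ t) (trans (cong (_⊕ t) e) e′)))))

  translate-leaf : ∀ i → ∃ λ j → f (leafX j) ≡ f (leafX i) ⊕ t
  translate-leaf i with landing (just i)
  ... | at-a e      = ⊥-elim (distinct (∙-cancelʳ t _ _ (trans e (sym c⊕t≡a))) λ ())
  ... | at-c e      = ⊥-elim (distinct (∙-cancelʳ t _ _ (trans e (sym b⊕t≡c))) λ ())
  ... | at-leaf j e = j , sym e

  x·t≡0 : x · t ≡ 0ᵛ
  x·t≡0 = ∙-cancelˡ ΣX _ _ (begin
    ΣX ⊕ (x · t)                  ≡⟨ cong (ΣX ⊕_) (sym (sum-replicate x {t})) ⟩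
    ΣX ⊕ ∑ {x} (λ _ → t)          ≡⟨ sym (∑-distrib-+ (f ∘ leafX) (λ _ → t)) ⟩
    ∑ (λ i → f (leafX i) ⊕ t)     ≡⟨ sum-cong-≗ (λ i → sym (proj₂ (translate-leaf i))) ⟩
    ∑ (f ∘ leafX ∘ σ)             ≡⟨ sum-reindex (f ∘ leafX) σ σ-injective ⟩
    ΣX                            ≡⟨ sym (identityʳ ΣX) ⟩
    ΣX ⊕ 0ᵛ                       ∎)
    where
    open ≡-Reasoning
    ΣX = ∑ (f ∘ leafX)
    σ = λ i → proj₁ (translate-leaf i)
    σ-injective : Injective _≡_ _≡_ σ
    σ-injective {i} {j} e with f-injective (∙-cancelʳ t _ _ (trans (sym (proj₂ (translate-leaf i)))
                                (trans (cong (f ∘ leafX) e) (proj₂ (translate-leaf j)))))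
    ... | refl = refl

  t≢0 : t ≢ 0ᵛ
  t≢0 t≡0 = distinct (trans (sym c⊕t≡a) (trans (cong (c ⊕_) t≡0) (identityʳ c))) λ ()

  x%3≡0 : x % 3 ≡ 0
  x%3≡0 with residue-cases x
  ... | inj₁ x0 = x0
  ... | inj₂ (inj₁ x1) = ⊥-elim (t≢0 (trans (sym (identityʳ t)) (trans (sym (·-residue x t x1)) x·t≡0)))
  ... | inj₂ (inj₂ x2) = ⊥-elim (t≢0 (trans (sym (identityʳ t)) (trans (cong (t ⊕_) (sym 2t≡0)) (triple t))))
    where
    2t≡0 : t ⊕ t ≡ 0ᵛ
    2t≡0 = trans (cong (t ⊕_) (sym (identityʳ t))) (trans (sym (·-residue x t x2)) x·t≡0)

-- Sufficiency

realise-collinear : ∀ {m x y z} t qx qy qz → x ≡ t + 3 * qx → y ≡ t + 3 * qy → z ≡ t + 3 * qz →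
  3 + x + y + z ≡ 3 ^ suc (suc m) → IsRainbow (suc (suc m)) (catEnds {x} {y} {z})
realise-collinear {m} t qx qy qz refl refl refl h =
  FromColouring.rainbow (collinear-rainbow (suc m) (qx ∷ qy ∷ qz ∷ t ∷ [])
    (*-cancelˡ-≡ _ _ 3 (trans (total t qx qy qz) h)))
  where
  total : ∀ t qx qy qz → 3 * suc (qx + (qy + (qz + (t + 0)))) ≡ 3 + (t + 3 * qx) + (t + 3 * qy) + (t + 3 * qz)
  total = solve-∀

realise-skew : ∀ {m x y z} β v → x ≡ (baseProfile β ⊞ skewProfile v) p₁ → y ≡ (baseProfile β ⊞ skewProfile v) p₂ →
  z ≡ (baseProfile β ⊞ skewProfile v) p₃ → 3 + x + y + z ≡ 3 ^ suc (suc m) → IsRainbow (suc (suc m)) (catEnds {x} {y} {z})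
realise-skew {m} β (a ∷ b ∷ c ∷ []) refl refl refl h = FromColouring.rainbow (skew-rainbow m β (a ∷ b ∷ c ∷ [])
  (*-cancelˡ-≡ _ _ 3 (trans (total (baseProfile β p₁) (baseProfile β p₂) (baseProfile β p₃) (base-total β)) h)))
  where
  base-total : ∀ β → baseProfile β p₁ + baseProfile β p₂ + baseProfile β p₃ ≡ 6
  base-total β₀₂₄ = refl
  base-total β₀₅₁ = refl
  base-total β₃₂₁ = refl
  base-total β₄₂₀ = refl
  base-total β₁₅₀ = refl
  base-total β₁₂₃ = refl
  base-total β₁₃₂ = refl
  base-total β₂₃₁ = refl
  total : ∀ r s t → r + s + t ≡ 6 → 3 * (3 + (a + (b + (c + 0)))) ≡ 3 + (r + 3 * a) + (s + 3 * b) + (t + 3 * c)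
  total r s t e = begin
    3 * (3 + (a + (b + (c + 0))))               ≡⟨ nine a b c ⟩
    (3 + 6) + 3 * (a + (b + c))                 ≡⟨ cong (λ w → (3 + w) + 3 * (a + (b + c))) (sym e) ⟩
    (3 + (r + s + t)) + 3 * (a + (b + c))       ≡⟨ spread r s t a b c ⟩
    3 + (r + 3 * a) + (s + 3 * b) + (t + 3 * c) ∎
    where
    open ≡-Reasoning
    nine : ∀ a b c → 3 * (3 + (a + (b + (c + 0)))) ≡ (3 + 6) + 3 * (a + (b + c))
    nine = solve-∀
    spread : ∀ r s t a b c → (3 + (r + s + t)) + 3 * (a + (b + c)) ≡ 3 + (r + 3 * a) + (s + 3 * b) + (t + 3 * c)
    spread = solve-∀

carry : ∀ r q → r + 3 * suc q ≡ (3 + r) + 3 * q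
carry = solve-∀

6≢3^[2+m] : ∀ m → 6 ≢ 3 ^ suc (suc m)
6≢3^[2+m] m e with 3^suc≡3+ m
... | w , e′ with trans e (trans (cong (3 *_) e′) (*-distribˡ-+ 3 3 w))
... | ()

skew-0-2-1 : ∀ {m x y z} qx qy qz → x ≡ 0 + 3 * qx → y ≡ 2 + 3 * qy → z ≡ 1 + 3 * qz →
  3 + x + y + z ≡ 3 ^ suc (suc m) → IsRainbow (suc (suc m)) (catEnds {x} {y} {z})
skew-0-2-1 (suc I) qy      qz      ex ey ez = realise-skew β₃₂₁ (I ∷ qy ∷ qz ∷ []) (trans ex (carry 0 I)) ey ez
skew-0-2-1 zero    (suc K) qz      ex ey ez = realise-skew β₀₅₁ (0 ∷ K ∷ qz ∷ []) ex (trans ey (carry 2 K)) ez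
skew-0-2-1 zero    zero    (suc J) ex ey ez = realise-skew β₀₂₄ (0 ∷ 0 ∷ J ∷ []) ex ey (trans ez (carry 1 J))
skew-0-2-1 {m} zero zero   zero    refl refl refl h = ⊥-elim (6≢3^[2+m] m h)

skew-1-2-0 : ∀ {m x y z} qx qy qz → x ≡ 1 + 3 * qx → y ≡ 2 + 3 * qy → z ≡ 0 + 3 * qz →
  3 + x + y + z ≡ 3 ^ suc (suc m) → IsRainbow (suc (suc m)) (catEnds {x} {y} {z})
skew-1-2-0 (suc I) qy      qz      ex ey ez = realise-skew β₄₂₀ (I ∷ qy ∷ qz ∷ []) (trans ex (carry 1 I)) ey ez
skew-1-2-0 zero    (suc K) qz      ex ey ez = realise-skew β₁₅₀ (0 ∷ K ∷ qz ∷ []) ex (trans ey (carry 2 K)) ez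
skew-1-2-0 zero    zero    (suc J) ex ey ez = realise-skew β₁₂₃ (0 ∷ 0 ∷ J ∷ []) ex ey (trans ez (carry 0 J))
skew-1-2-0 {m} zero zero   zero    refl refl refl h = ⊥-elim (6≢3^[2+m] m h)

skew-1-0-2 : ∀ {m x y z} qx qy qz → x ≡ 1 + 3 * qx → y ≡ 0 + 3 * qy → z ≡ 2 + 3 * qz → y ≢ 0 →
  3 + x + y + z ≡ 3 ^ suc (suc m) → IsRainbow (suc (suc m)) (catEnds {x} {y} {z})
skew-1-0-2 qx zero    qz ex ey ez y≢0 = ⊥-elim (y≢0 ey)
skew-1-0-2 qx (suc K) qz ex ey ez _   = realise-skew β₁₃₂ (qx ∷ K ∷ qz ∷ []) ex (trans ey (carry 0 K)) ez

skew-2-0-1 : ∀ {m x y z} qx qy qz → x ≡ 2 + 3 * qx → y ≡ 0 + 3 * qy → z ≡ 1 + 3 * qz → y ≢ 0 →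
  3 + x + y + z ≡ 3 ^ suc (suc m) → IsRainbow (suc (suc m)) (catEnds {x} {y} {z})
skew-2-0-1 qx zero    qz ex ey ez y≢0 = ⊥-elim (y≢0 ey)
skew-2-0-1 qx (suc K) qz ex ey ez _   = realise-skew β₂₃₁ (qx ∷ K ∷ qz ∷ []) ex (trans ey (carry 0 K)) ez

Excluded : ℕ → ℕ → ℕ → Set
Excluded x y z = (((x % 3 ≡ 0) × (z % 3 ≡ 2)) ⊎ ((x % 3 ≡ 2) × (z % 3 ≡ 0)))
  ⊎ ((y ≡ 0) × (((x % 3 ≡ 1) × (z % 3 ≡ 2)) ⊎ ((x % 3 ≡ 2) × (z % 3 ≡ 1))))

sufficiency : ∀ m x y z → 3 + x + y + z ≡ 3 ^ suc (suc m) → ¬ Excluded x y z →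
  IsRainbow (suc (suc m)) (catEnds {x} {y} {z})
sufficiency m x y z h allowed = by-residues (residue-cases x) (residue-cases z)
  where
  y-residue : ∀ {r s} → x % 3 ≡ r → z % 3 ≡ s → y % 3 ≡ (6 ∸ (r + s)) % 3
  y-residue = residue-y (suc m) x y z h
  by-residues : x % 3 ≡ 0 ⊎ x % 3 ≡ 1 ⊎ x % 3 ≡ 2 → z % 3 ≡ 0 ⊎ z % 3 ≡ 1 ⊎ z % 3 ≡ 2 →
    IsRainbow (suc (suc m)) (catEnds {x} {y} {z})
  by-residues (inj₁ x0) (inj₁ z0) =
    realise-collinear 0 (x / 3) (y / 3) (z / 3) (decompose x0) (decompose (y-residue x0 z0)) (decompose z0) h
  by-residues (inj₂ (inj₁ x1)) (inj₂ (inj₁ z1)) =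
    realise-collinear 1 (x / 3) (y / 3) (z / 3) (decompose x1) (decompose (y-residue x1 z1)) (decompose z1) h
  by-residues (inj₂ (inj₂ x2)) (inj₂ (inj₂ z2)) =
    realise-collinear 2 (x / 3) (y / 3) (z / 3) (decompose x2) (decompose (y-residue x2 z2)) (decompose z2) h
  by-residues (inj₁ x0) (inj₂ (inj₂ z2)) = ⊥-elim (allowed (inj₁ (inj₁ (x0 , z2))))
  by-residues (inj₂ (inj₂ x2)) (inj₁ z0) = ⊥-elim (allowed (inj₁ (inj₂ (x2 , z0))))
  by-residues (inj₁ x0) (inj₂ (inj₁ z1)) =
    skew-0-2-1 (x / 3) (y / 3) (z / 3) (decompose x0) (decompose (y-residue x0 z1)) (decompose z1) h
  by-residues (inj₂ (inj₁ x1)) (inj₁ z0) =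
    skew-1-2-0 (x / 3) (y / 3) (z / 3) (decompose x1) (decompose (y-residue x1 z0)) (decompose z0) h
  by-residues (inj₂ (inj₁ x1)) (inj₂ (inj₂ z2)) =
    skew-1-0-2 (x / 3) (y / 3) (z / 3) (decompose x1) (decompose (y-residue x1 z2)) (decompose z2)
      (λ y≡0 → allowed (inj₂ (y≡0 , inj₁ (x1 , z2)))) h
  by-residues (inj₂ (inj₂ x2)) (inj₂ (inj₁ z1)) =
    skew-2-0-1 (x / 3) (y / 3) (z / 3) (decompose x2) (decompose (y-residue x2 z1)) (decompose z1)
      (λ y≡0 → allowed (inj₂ (y≡0 , inj₂ (x2 , z1)))) h

theorem6 : (k x y z : ℕ) → 1 < k → 3 + x + y + z ≡ 3 ^ k →
    IsRainbow k (catEnds {x} {y} {z}) ⇔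
    (¬ ((((x % 3 ≡ 0) × (z % 3 ≡ 2)) ⊎ ((x % 3 ≡ 2) × (z % 3 ≡ 0)))
       ⊎ ((y ≡ 0) × (((x % 3 ≡ 1) × (z % 3 ≡ 2)) ⊎ ((x % 3 ≡ 2) × (z % 3 ≡ 1))))))
theorem6 (suc (suc m)) x y z (s≤s (s≤s z≤n)) h = mk⇔ necessity (sufficiency m x y z h)
  where
  necessity : IsRainbow (suc (suc m)) (catEnds {x} {y} {z}) → ¬ Excluded x y z
  necessity (f , R) (inj₁ (inj₁ (x0 , z2))) = Labelling.no-residues-0-1-2 f R x0 (residue-y (suc m) x y z h x0 z2) z2
  necessity (f , R) (inj₁ (inj₂ (x2 , z0))) = Labelling.no-residues-2-1-0 f R x2 (residue-y (suc m) x y z h x2 z0) z0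
  necessity (f , R) (inj₂ (refl , inj₁ (x1 , _))) with trans (sym x1) (Translation.x%3≡0 f R)
  ... | ()
  necessity (f , R) (inj₂ (refl , inj₂ (x2 , _))) with trans (sym x2) (Translation.x%3≡0 f R)
  ... | ()
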